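{- Let $(\alpha_n)_{n\ge0}$ be a sequence of complex numbers, $A_n(x)=\sum_{\nu=0}^{n}\binom{n}{\nu}\alpha_{n-\nu}x^\nu$, and assume $A_m(1-x)=(-1)^mA_m(x)$ for all $m\ge0$. Let $n\ge1$ be odd. Then for $(n+1)/2\le k\le n$, $$\sum_{\nu=0}^{k}\binom{2k-n}{k-\nu}a_{n,\nu}=0,\qquad \sum_{\nu=0}^{k}\binom{2k-n}{k-\nu}\binom{n}{\nu}\alpha_{n-\nu,\nu}=0,\qquad \sum_{\nu=0}^{k}\binom{2k-\nu}{k}\binom{n}{\nu}\alpha_{n-\nu}=0.$$
   Context: $\alpha_0=0$ is allowed. For $0\le j\le n$, $a_{n,j}=\sum_{\nu=j}^{n}\binom{n}{\nu}\binom{\nu}{j}\alpha_\nu$. For $r,s\ge0$, $\alpha_{r,s}=\sum_{\nu=0}^{r}\binom{r}{\nu}\alpha_{s+\nu}$. -}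

module Defs where

open import Algebra.Bundles using (CommutativeRing)
open import Data.Nat using (ℕ; zero; suc; _∸_) renaming (_+_ to _+ℕ_)
open import Data.Nat.Combinatorics using (_C_)
open import Level using (_⊔_)

-- Everything is parametrised by a commutative ring R (the coefficient ring;
-- the paper uses ℂ).
module _ {c ℓ} (R : CommutativeRing c ℓ) where
  open CommutativeRing R

  ι : ℕ → Carrier
  ι zero    = 0#
  ι (suc n) = 1# + ι n

  pow : Carrier → ℕ → Carrier
  pow x zero    = 1#
  pow x (suc n) = x * pow x n

  sumTo : ℕ → (ℕ → Carrier) → Carrier
  sumTo zero    f = f 0
  sumTo (suc n) f = sumTo n f + f (suc n)

  -- R has no additive torsion: (k+1)·x = 0 implies x = 0  (true for ℂ)
  TorsionFree : Set (c ⊔ ℓ)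
  TorsionFree = ∀ (k : ℕ) (x : Carrier) → ι (suc k) * x ≈ 0# → x ≈ 0#

  A : (ℕ → Carrier) → ℕ → Carrier → Carrier
  A α n x = sumTo n (λ ν → ι (n C ν) * α (n ∸ ν) * pow x ν)

  -- a_{n,j} = Σ_{ν=j}^{n} C(n,ν) C(ν,j) α_ν  (terms with ν < j vanish since C(ν,j)=0)
  a : (ℕ → Carrier) → ℕ → ℕ → Carrier
  a α n j = sumTo n (λ ν → ι (n C ν) * ι (ν C j) * α ν)

  α₂ : (ℕ → Carrier) → ℕ → ℕ → Carrier
  α₂ α r s = sumTo r (λ ν → ι (r C ν) * α (s +ℕ ν))

-- Setting x = 0 in the reflection identity gives α_{m,0} = (-1)^m α_m, and Pascal's rule
-- α_{r+1,s} = α_{r,s} + α_{r,s+1} propagates this to α_{r,s} = (-1)^{r+s} α_{s,r}.  As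
-- a_{k+l,k} = C(k+l,k) α_{l,k}, this is the symmetry a_{n,k} = (-1)^n a_{n,n-k}.  The numbers
-- b(n,d,k) = Σ_μ C(n,μ) C(d+μ,k) α_μ, the coefficients of (1+x)^d Σ_j a_{n,j} x^j, inherit it by
-- Pascal's rule in d: b(n,d,k) = (-1)^n b(n,d,l) whenever k + l = n + d.  For odd n and
-- d = 2k - n this forces b(n,d,k) = 0, as R has no 2-torsion.  Each of the three sums equals
-- b(n,d,k): the first by Vandermonde's identity, the second since C(n,ν) α_{n-ν,ν} = a_{n,ν},
-- the third after reversing the order of summation.
module Submission where

open import Defs
open import Level using (Level)
open import Algebra.Bundles using (CommutativeRing)
open import Data.Nat using (ℕ; zero; suc; _≤_; _<_; _∸_; _/_; _%_; z≤n; s≤s)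
  renaming (_*_ to _*ℕ_; _+_ to _+ℕ_)
open import Data.Nat.Combinatorics using (_C_; k>n⇒nCk≡0; nCk≡nC[n∸k]; nCk+nC[k+1]≡[n+1]C[k+1])
import Data.Nat.Properties as ℕ
open import Data.Product using (_×_; _,_)
open import Data.Sum using (inj₁; inj₂)
open import Relation.Nullary using (yes; no)
open import Relation.Binary.PropositionalEquality using (_≡_; cong; subst)
import Relation.Binary.PropositionalEquality as ≡

module _ where
  open import Data.Nat
  open import Data.Nat.Properties
  open import Data.Nat.Combinatorics using (nCk≡n!/k![n-k]!; k![n∸k]!∣n!)
  open import Data.Nat.DivMod using (m/n*n≡m; m*n/n≡m; m≡m%n+[m/n]*n)
  open import Data.Nat.Tactic.RingSolver using (solve-∀)
  open ≡ using (sym; trans)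
  open ≡.≡-Reasoning

  choose-mul-factorials : ∀ x y → ((x + y) C x) * (x ! * y !) ≡ (x + y) !
  choose-mul-factorials x y = begin
    ((x + y) C x) * (x ! * y !)           ≡⟨ cong (λ z → ((x + y) C x) * (x ! * z !)) (m+n∸m≡n x y) ⟨
    ((x + y) C x) * (x ! * (x + y ∸ x) !) ≡⟨ cong (_* (x ! * (x + y ∸ x) !)) (nCk≡n!/k![n-k]! x≤x+y) ⟩
    (x + y) ! / (x ! * (x + y ∸ x) !) * (x ! * (x + y ∸ x) !) ≡⟨ m/n*n≡m (k![n∸k]!∣n! x≤x+y) ⟩
    (x + y) !                             ∎
    where
    x≤x+y : x ≤ x + y
    x≤x+y = m≤m+n x y
    instance _ = x !* (x + y ∸ x) !≢0

  -- Both sides, multiplied by k! j! c!, equal (k + j + c)!.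
  choose-mul-choose : ∀ k l j → ((k + l) C (k + j)) * ((k + j) C k) ≡ ((k + l) C k) * (l C j)
  choose-mul-choose k l j with j ≤? l
  ... | no j≰l = begin
    ((k + l) C (k + j)) * ((k + j) C k) ≡⟨ cong (_* ((k + j) C k)) (k>n⇒nCk≡0 (+-monoʳ-< k (≰⇒> j≰l))) ⟩
    0                                   ≡⟨ *-zeroʳ ((k + l) C k) ⟨
    ((k + l) C k) * 0                   ≡⟨ cong (((k + l) C k) *_) (k>n⇒nCk≡0 (≰⇒> j≰l)) ⟨
    ((k + l) C k) * (l C j)             ∎
  ... | yes j≤l rewrite sym (m+[n∸m]≡n j≤l) =
    *-cancelʳ-≡ _ _ (k ! * (j ! * c !)) {{m*n≢0 _ _ {{k !≢0}} {{m*n≢0 _ _ {{j !≢0}} {{c !≢0}}}}}} (begin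
      (K C (k + j)) * ((k + j) C k) * (k ! * (j ! * c !)) ≡⟨ shuffleˡ (K C (k + j)) ((k + j) C k) (k !) (j !) (c !) ⟩
      (K C (k + j)) * (((k + j) C k) * (k ! * j !) * c !) ≡⟨ cong (λ z → (K C (k + j)) * (z * c !)) (choose-mul-factorials k j) ⟩
      (K C (k + j)) * ((k + j) ! * c !)                    ≡⟨ split-after ⟩
      K !                                                  ≡⟨ choose-mul-factorials k (j + c) ⟨
      (K C k) * (k ! * (j + c) !)                          ≡⟨ cong (λ z → (K C k) * (k ! * z)) (choose-mul-factorials j c) ⟨
      (K C k) * (k ! * (((j + c) C j) * (j ! * c !)))      ≡⟨ shuffleʳ (K C k) ((j + c) C j) (k !) (j !) (c !) ⟨
      (K C k) * ((j + c) C j) * (k ! * (j ! * c !))        ∎)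
    where
    c K : ℕ
    c = l ∸ j
    K = k + (j + c)
    split-after : (K C (k + j)) * ((k + j) ! * c !) ≡ K !
    split-after = subst (λ m → (m C (k + j)) * ((k + j) ! * c !) ≡ m !) (+-assoc k j c) (choose-mul-factorials (k + j) c)
    shuffleˡ : ∀ a b x y z → a * b * (x * (y * z)) ≡ a * (b * (x * y) * z)
    shuffleˡ = solve-∀
    shuffleʳ : ∀ a b x y z → a * b * (x * (y * z)) ≡ a * (x * (b * (y * z)))
    shuffleʳ = solve-∀

  choose-symmetric : ∀ k l → (k + l) C k ≡ (k + l) C l
  choose-symmetric k l = trans (nCk≡nC[n∸k] (m≤m+n k l)) (cong ((k + l) C_) (m+n∸m≡n k l))

  odd⇒n≡1+[n/2]*2 : ∀ {n} → n % 2 ≡ 1 → n ≡ suc (n / 2 * 2)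
  odd⇒n≡1+[n/2]*2 {n} odd = trans (m≡m%n+[m/n]*n n 2) (cong (_+ n / 2 * 2) odd)

  odd∧[1+n]/2≤k⇒n<2k : ∀ {n k} → n % 2 ≡ 1 → suc n / 2 ≤ k → n < 2 * k
  odd∧[1+n]/2≤k⇒n<2k {n} {k} odd half≤k =
    subst (_< 2 * k) (sym n≡1+2q) (≤-trans (*-monoˡ-≤ 2 1+q≤k) (≤-reflexive (*-comm k 2)))
    where
    q : ℕ
    q = n / 2
    n≡1+2q : n ≡ suc (q * 2)
    n≡1+2q = odd⇒n≡1+[n/2]*2 odd
    1+q≤k : suc q ≤ k
    1+q≤k = subst (_≤ k) (trans (cong (λ m → suc m / 2) n≡1+2q) (m*n/n≡m (suc q) 2)) half≤k

  m∸[n∸o]≡m∸n+o : ∀ {m n o} → n ≤ m → o ≤ n → m ∸ (n ∸ o) ≡ m ∸ n + o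
  m∸[n∸o]≡m∸n+o {m} {n} {o} n≤m o≤n = begin
    m ∸ (n ∸ o)                ≡⟨ cong (_∸ (n ∸ o)) (m∸n+n≡m n≤m) ⟨
    (m ∸ n + n) ∸ (n ∸ o)      ≡⟨ +-∸-assoc (m ∸ n) (m∸n≤m n o) ⟩
    m ∸ n + (n ∸ (n ∸ o))      ≡⟨ cong (m ∸ n +_) (m∸[m∸n]≡n o≤n) ⟩
    m ∸ n + o                  ∎

  k<ν≤2k⇒2k∸ν<k : ∀ {k ν} → k < ν → ν ≤ 2 * k → 2 * k ∸ ν < k
  k<ν≤2k⇒2k∸ν<k {k} {ν} k<ν ν≤2k =
    subst (2 * k ∸ ν <_) (trans (m+n∸m≡n k (k + 0)) (+-identityʳ k)) (∸-monoʳ-< k<ν ν≤2k)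

module BinomialSums {c ℓ} (R : CommutativeRing c ℓ) where
  open CommutativeRing R hiding (zero)
  open import Relation.Binary.Reasoning.Setoid setoid
  open import Algebra.Properties.Ring ring using (-1*x≈-x; -0#≈0#; -‿involutive; -‿distribˡ-*; -‿+-comm; xyx⁻¹≈y)
  open import Algebra.Properties.CommutativeSemigroup +-commutativeSemigroup
    using () renaming (interchange to +-interchange; x∙yz≈xz∙y to +-x∙yz≈xz∙y; x∙yz≈y∙xz to +-x∙yz≈y∙xz)
  open import Algebra.Properties.CommutativeSemigroup *-commutativeSemigroup using (x∙yz≈y∙xz; xy∙z≈xz∙y)
  open import Algebra.Properties.Monoid.Mult +-monoid using (×-homo-+) renaming (_×_ to _·_)
  open import Algebra.Properties.Semiring.Mult semiring using (×1-homo-*)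

  ε : ℕ → Carrier
  ε = pow R (- 1#)

  sumTo-cong : ∀ n {f g} → (∀ i → f i ≈ g i) → sumTo R n f ≈ sumTo R n g
  sumTo-cong zero    f≈g = f≈g 0
  sumTo-cong (suc n) f≈g = +-cong (sumTo-cong n f≈g) (f≈g (suc n))

  sumTo-cong-≤ : ∀ n {f g} → (∀ i → i ≤ n → f i ≈ g i) → sumTo R n f ≈ sumTo R n g
  sumTo-cong-≤ zero    f≈g = f≈g 0 z≤n
  sumTo-cong-≤ (suc n) f≈g = +-cong (sumTo-cong-≤ n (λ i i≤n → f≈g i (ℕ.m≤n⇒m≤1+n i≤n))) (f≈g (suc n) ℕ.≤-refl)

  sumTo-zero : ∀ n {f} → (∀ i → i ≤ n → f i ≈ 0#) → sumTo R n f ≈ 0#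
  sumTo-zero n f≈0 = trans (sumTo-cong-≤ n f≈0) (zero-sum n)
    where
    zero-sum : ∀ n → sumTo R n (λ _ → 0#) ≈ 0#
    zero-sum zero    = refl
    zero-sum (suc n) = trans (+-identityʳ _) (zero-sum n)

  sumTo-+ : ∀ n f g → sumTo R n (λ i → f i + g i) ≈ sumTo R n f + sumTo R n g
  sumTo-+ zero    f g = refl
  sumTo-+ (suc n) f g = trans (+-congʳ (sumTo-+ n f g)) (+-interchange _ _ _ _)

  sumTo-*ˡ : ∀ n x f → sumTo R n (λ i → x * f i) ≈ x * sumTo R n f
  sumTo-*ˡ zero    x f = refl
  sumTo-*ˡ (suc n) x f = trans (+-congʳ (sumTo-*ˡ n x f)) (sym (distribˡ x _ _))

  sumTo-unroll : ∀ n f → sumTo R (suc n) f ≈ f 0 + sumTo R n (λ i → f (suc i))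
  sumTo-unroll zero    f = refl
  sumTo-unroll (suc n) f = trans (+-congʳ (sumTo-unroll n f)) (+-assoc _ _ _)

  sumTo-reverse : ∀ n f → sumTo R n f ≈ sumTo R n (λ i → f (n ∸ i))
  sumTo-reverse zero    f = refl
  sumTo-reverse (suc n) f = begin
    sumTo R n f + f (suc n)                          ≈⟨ +-congʳ (sumTo-reverse n f) ⟩
    sumTo R n (λ i → f (n ∸ i)) + f (suc n)          ≈⟨ +-comm _ _ ⟩
    f (suc n) + sumTo R n (λ i → f (suc n ∸ suc i))  ≈⟨ sumTo-unroll n (λ i → f (suc n ∸ i)) ⟨
    sumTo R (suc n) (λ i → f (suc n ∸ i))            ∎

  sumTo-swap : ∀ m n (f : ℕ → ℕ → Carrier) →
    sumTo R m (λ i → sumTo R n (f i)) ≈ sumTo R n (λ j → sumTo R m (λ i → f i j))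
  sumTo-swap zero    n f = refl
  sumTo-swap (suc m) n f = trans (+-congʳ (sumTo-swap m n f)) (sym (sumTo-+ n _ _))

  sumTo-truncate : ∀ n k f → k ≤ n → (∀ i → k < i → i ≤ n → f i ≈ 0#) → sumTo R n f ≈ sumTo R k f
  sumTo-truncate zero    k f z≤n _ = refl
  sumTo-truncate (suc n) k f k≤1+n f≈0 with ℕ.m≤n⇒m<n∨m≡n k≤1+n
  ... | inj₂ ≡.refl = refl
  ... | inj₁ k<1+n = trans (+-cong (sumTo-truncate n k f (ℕ.≤-pred k<1+n) (λ i k<i i≤n → f≈0 i k<i (ℕ.m≤n⇒m≤1+n i≤n)))
                                   (f≈0 (suc n) k<1+n ℕ.≤-refl))
                           (+-identityʳ _)

  sumTo-drop : ∀ k l f → (∀ i → i < k → f i ≈ 0#) → sumTo R (k +ℕ l) f ≈ sumTo R l (λ j → f (k +ℕ j))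
  sumTo-drop zero    l f _   = refl
  sumTo-drop (suc k) l f f≈0 = begin
    sumTo R (suc (k +ℕ l)) f                      ≈⟨ sumTo-unroll (k +ℕ l) f ⟩
    f 0 + sumTo R (k +ℕ l) (λ i → f (suc i))      ≈⟨ +-cong (f≈0 0 (s≤s z≤n)) (sumTo-drop k l _ (λ i i<k → f≈0 (suc i) (s≤s i<k))) ⟩
    0# + sumTo R l (λ j → f (suc (k +ℕ j)))       ≈⟨ +-identityˡ _ ⟩
    sumTo R l (λ j → f (suc k +ℕ j))              ∎

  ι≈·1 : ∀ n → ι R n ≈ n · 1#
  ι≈·1 zero    = refl
  ι≈·1 (suc n) = +-congˡ (ι≈·1 n)

  ι-homo-+ : ∀ m n → ι R (m +ℕ n) ≈ ι R m + ι R n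
  ι-homo-+ m n = begin
    ι R (m +ℕ n)        ≈⟨ ι≈·1 (m +ℕ n) ⟩
    (m +ℕ n) · 1#       ≈⟨ ×-homo-+ 1# m n ⟩
    m · 1# + n · 1#     ≈⟨ +-cong (ι≈·1 m) (ι≈·1 n) ⟨
    ι R m + ι R n       ∎

  ι-homo-* : ∀ m n → ι R (m *ℕ n) ≈ ι R m * ι R n
  ι-homo-* m n = begin
    ι R (m *ℕ n)          ≈⟨ ι≈·1 (m *ℕ n) ⟩
    (m *ℕ n) · 1#         ≈⟨ ×1-homo-* m n ⟩
    (m · 1#) * (n · 1#)   ≈⟨ *-cong (ι≈·1 m) (ι≈·1 n) ⟨
    ι R m * ι R n         ∎

  ι-1 : ι R 1 ≈ 1#
  ι-1 = +-identityʳ 1#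

  ι-C-pascal : ∀ n k → ι R (suc n C suc k) ≈ ι R (n C k) + ι R (n C suc k)
  ι-C-pascal n k = trans (reflexive (cong (ι R) (≡.sym (nCk+nC[k+1]≡[n+1]C[k+1] n k)))) (ι-homo-+ (n C k) (n C suc k))

  ι-C-vanish : ∀ {n k} → n < k → ι R (n C k) ≈ 0#
  ι-C-vanish n<k = reflexive (cong (ι R) (k>n⇒nCk≡0 n<k))

  ε-suc : ∀ n → ε (suc n) ≈ - ε n
  ε-suc n = -1*x≈-x (ε n)

  ε-even : ∀ q → ε (q *ℕ 2) ≈ 1#
  ε-even zero    = refl
  ε-even (suc q) = begin
    - 1# * (- 1# * ε (q *ℕ 2))  ≈⟨ -1*x≈-x _ ⟩
    - (- 1# * ε (q *ℕ 2))       ≈⟨ -‿cong (-1*x≈-x _) ⟩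
    - - ε (q *ℕ 2)              ≈⟨ -‿involutive _ ⟩
    ε (q *ℕ 2)                  ≈⟨ ε-even q ⟩
    1#                          ∎

  ε-odd : ∀ n → n % 2 ≡ 1 → ∀ x → ε n * x ≈ - x
  ε-odd n odd x = begin
    ε n * x                        ≡⟨ cong (λ m → ε m * x) (odd⇒n≡1+[n/2]*2 {n} odd) ⟩
    - 1# * ε (n / 2 *ℕ 2) * x      ≈⟨ *-congʳ (*-congˡ (ε-even (n / 2))) ⟩
    - 1# * 1# * x                  ≈⟨ *-congʳ (*-identityʳ _) ⟩
    - 1# * x                       ≈⟨ -1*x≈-x x ⟩
    - x                            ∎

  x≈-x⇒x≈0 : TorsionFree R → ∀ {x} → x ≈ - x → x ≈ 0#
  x≈-x⇒x≈0 torsionFree {x} x≈-x = torsionFree 1 x (begin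
    (1# + (1# + 0#)) * x  ≈⟨ *-congʳ (+-congˡ ι-1) ⟩
    (1# + 1#) * x         ≈⟨ distribʳ x 1# 1# ⟩
    1# * x + 1# * x       ≈⟨ +-cong (*-identityˡ x) (*-identityˡ x) ⟩
    x + x                 ≈⟨ +-congˡ x≈-x ⟩
    x - x                 ≈⟨ -‿inverseʳ x ⟩
    0#                    ∎)

  sumTo-pascal : ∀ n (f : ℕ → Carrier) →
    sumTo R (suc n) (λ ν → ι R (suc n C ν) * f ν)
      ≈ sumTo R n (λ ν → ι R (n C ν) * f ν) + sumTo R n (λ ν → ι R (n C ν) * f (suc ν))
  sumTo-pascal n f = begin
    sumTo R (suc n) (λ ν → ι R (suc n C ν) * f ν)
      ≈⟨ sumTo-unroll n (λ ν → ι R (suc n C ν) * f ν) ⟩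
    head + sumTo R n (λ ν → ι R (suc n C suc ν) * f (suc ν))
      ≈⟨ +-congˡ (trans (sumTo-cong n (λ ν → trans (*-congʳ (ι-C-pascal n ν)) (distribʳ _ _ _)))
                        (sumTo-+ n (λ ν → ι R (n C ν) * f (suc ν)) (λ ν → ι R (n C suc ν) * f (suc ν)))) ⟩
    head + (sumTo R n (λ ν → ι R (n C ν) * f (suc ν)) + sumTo R n (λ ν → ι R (n C suc ν) * f (suc ν)))
      ≈⟨ +-x∙yz≈xz∙y _ _ _ ⟩
    (head + sumTo R n (λ ν → ι R (n C suc ν) * f (suc ν))) + sumTo R n (λ ν → ι R (n C ν) * f (suc ν))
      ≈⟨ +-congʳ (sumTo-unroll n (λ ν → ι R (n C ν) * f ν)) ⟨
    sumTo R (suc n) (λ ν → ι R (n C ν) * f ν) + sumTo R n (λ ν → ι R (n C ν) * f (suc ν))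
      ≈⟨ +-congʳ (trans (+-congˡ (trans (*-congʳ (ι-C-vanish (ℕ.n<1+n n))) (zeroˡ _))) (+-identityʳ _)) ⟩
    sumTo R n (λ ν → ι R (n C ν) * f ν) + sumTo R n (λ ν → ι R (n C ν) * f (suc ν)) ∎
    where
    head : Carrier
    head = ι R (n C 0) * f 0

  vandermonde : ∀ d μ k → sumTo R k (λ ν → ι R (d C (k ∸ ν)) * ι R (μ C ν)) ≈ ι R ((μ +ℕ d) C k)
  vandermonde d zero k =
    trans (sumTo-truncate k 0 f z≤n vanish) (trans (*-congˡ ι-1) (*-identityʳ _))
    where
    f : ℕ → Carrier
    f ν = ι R (d C (k ∸ ν)) * ι R (0 C ν)
    vanish : ∀ ν → 0 < ν → ν ≤ k → f ν ≈ 0#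
    vanish (suc ν) _ _ = trans (*-congˡ (ι-C-vanish (ℕ.0<1+n {ν}))) (zeroʳ _)
  vandermonde d (suc μ) zero = trans (*-congʳ ι-1) (*-identityˡ _)
  vandermonde d (suc μ) (suc k) = begin
    sumTo R (suc k) (λ ν → ι R (d C (suc k ∸ ν)) * ι R (suc μ C ν))
      ≈⟨ sumTo-unroll k (λ ν → ι R (d C (suc k ∸ ν)) * ι R (suc μ C ν)) ⟩
    head + sumTo R k (λ ν → D ν * ι R (suc μ C suc ν))
      ≈⟨ +-congˡ (trans (sumTo-cong k (λ ν → trans (*-congˡ (ι-C-pascal μ ν)) (distribˡ _ _ _)))
                        (sumTo-+ k (λ ν → D ν * ι R (μ C ν)) (λ ν → D ν * ι R (μ C suc ν)))) ⟩
    head + (sumTo R k (λ ν → D ν * ι R (μ C ν)) + sumTo R k (λ ν → D ν * ι R (μ C suc ν)))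
      ≈⟨ +-x∙yz≈y∙xz _ _ _ ⟩
    sumTo R k (λ ν → D ν * ι R (μ C ν)) + (head + sumTo R k (λ ν → D ν * ι R (μ C suc ν)))
      ≈⟨ +-congˡ (sumTo-unroll k (λ ν → ι R (d C (suc k ∸ ν)) * ι R (μ C ν))) ⟨
    sumTo R k (λ ν → D ν * ι R (μ C ν)) + sumTo R (suc k) (λ ν → ι R (d C (suc k ∸ ν)) * ι R (μ C ν))
      ≈⟨ +-cong (vandermonde d μ k) (vandermonde d μ (suc k)) ⟩
    ι R ((μ +ℕ d) C k) + ι R ((μ +ℕ d) C suc k)
      ≈⟨ ι-C-pascal (μ +ℕ d) k ⟨
    ι R ((suc μ +ℕ d) C suc k) ∎
    where
    head : Carrier
    head = ι R (d C suc k) * ι R (suc μ C 0)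
    D : ℕ → Carrier
    D ν = ι R (d C (k ∸ ν))

  module _ (α : ℕ → Carrier) where

    α₂-pascal : ∀ r s → α₂ R α (suc r) s ≈ α₂ R α r s + α₂ R α r (suc s)
    α₂-pascal r s = trans (sumTo-pascal r (λ ν → α (s +ℕ ν)))
      (+-congˡ (sumTo-cong r (λ ν → *-congˡ (reflexive (cong α (ℕ.+-suc s ν))))))

    a-as-α₂ : ∀ {n} k l → k +ℕ l ≡ n → a R α n k ≈ ι R (n C k) * α₂ R α l k
    a-as-α₂ k l ≡.refl = begin
      a R α (k +ℕ l) k
        ≈⟨ sumTo-drop k l f (λ μ μ<k → trans (*-congʳ (*-congˡ (ι-C-vanish μ<k))) (trans (*-congʳ (zeroʳ _)) (zeroˡ _))) ⟩
      sumTo R l (λ j → f (k +ℕ j))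
        ≈⟨ sumTo-cong l term ⟩
      sumTo R l (λ j → ι R ((k +ℕ l) C k) * (ι R (l C j) * α (k +ℕ j)))
        ≈⟨ sumTo-*ˡ l _ _ ⟩
      ι R ((k +ℕ l) C k) * α₂ R α l k ∎
      where
      f : ℕ → Carrier
      f μ = ι R ((k +ℕ l) C μ) * ι R (μ C k) * α μ
      term : ∀ j → f (k +ℕ j) ≈ ι R ((k +ℕ l) C k) * (ι R (l C j) * α (k +ℕ j))
      term j = begin
        ι R ((k +ℕ l) C (k +ℕ j)) * ι R ((k +ℕ j) C k) * α (k +ℕ j)
          ≈⟨ *-congʳ (ι-homo-* ((k +ℕ l) C (k +ℕ j)) ((k +ℕ j) C k)) ⟨
        ι R (((k +ℕ l) C (k +ℕ j)) *ℕ ((k +ℕ j) C k)) * α (k +ℕ j)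
          ≡⟨ cong (λ m → ι R m * α (k +ℕ j)) (choose-mul-choose k l j) ⟩
        ι R (((k +ℕ l) C k) *ℕ (l C j)) * α (k +ℕ j)
          ≈⟨ *-congʳ (ι-homo-* ((k +ℕ l) C k) (l C j)) ⟩
        ι R ((k +ℕ l) C k) * ι R (l C j) * α (k +ℕ j)
          ≈⟨ *-assoc _ _ _ ⟩
        ι R ((k +ℕ l) C k) * (ι R (l C j) * α (k +ℕ j)) ∎

    choose-mul-α₂ : ∀ n ν → ι R (n C ν) * α₂ R α (n ∸ ν) ν ≈ a R α n ν
    choose-mul-α₂ n ν with ν ℕ.≤? n
    ... | yes ν≤n = sym (a-as-α₂ ν (n ∸ ν) (ℕ.m+[n∸m]≡n ν≤n))
    ... | no ν≰n = begin
      ι R (n C ν) * α₂ R α (n ∸ ν) ν  ≈⟨ trans (*-congʳ (ι-C-vanish (ℕ.≰⇒> ν≰n))) (zeroˡ _) ⟩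
      0#                              ≈⟨ sumTo-zero n (λ μ μ≤n → vanish μ (ℕ.≤-<-trans μ≤n (ℕ.≰⇒> ν≰n))) ⟨
      a R α n ν                       ∎
      where
      vanish : ∀ μ → μ < ν → ι R (n C μ) * ι R (μ C ν) * α μ ≈ 0#
      vanish μ μ<ν = trans (*-congʳ (trans (*-congˡ (ι-C-vanish μ<ν)) (zeroʳ _))) (zeroˡ _)

    b : ℕ → ℕ → ℕ → Carrier
    b n d k = sumTo R n (λ μ → ι R (n C μ) * ι R ((d +ℕ μ) C k) * α μ)

    b-pascal : ∀ n d k → b n (suc d) (suc k) ≈ b n d k + b n d (suc k)
    b-pascal n d k = trans (sumTo-cong n term) (sumTo-+ n _ _)
      where
      term : ∀ μ → ι R (n C μ) * ι R (suc (d +ℕ μ) C suc k) * α μ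
                 ≈ ι R (n C μ) * ι R ((d +ℕ μ) C k) * α μ + ι R (n C μ) * ι R ((d +ℕ μ) C suc k) * α μ
      term μ = trans (*-congʳ (trans (*-congˡ (ι-C-pascal (d +ℕ μ) k)) (distribˡ _ _ _))) (distribʳ _ _ _)

    b-vanish : ∀ n d k → n +ℕ d < k → b n d k ≈ 0#
    b-vanish n d k n+d<k = sumTo-zero n (λ μ μ≤n →
      trans (*-congʳ (trans (*-congˡ (ι-C-vanish (d+μ<k μ μ≤n))) (zeroʳ _))) (zeroˡ _))
      where
      d+μ<k : ∀ μ → μ ≤ n → d +ℕ μ < k
      d+μ<k μ μ≤n = ℕ.≤-<-trans (ℕ.≤-trans (ℕ.+-monoʳ-≤ d μ≤n) (ℕ.≤-reflexive (ℕ.+-comm d n))) n+d<k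

    b-top : ∀ n d {l} → l ≡ n +ℕ suc d → b n (suc d) l ≈ b n d (n +ℕ d)
    b-top n d ≡.refl = begin
      b n (suc d) (n +ℕ suc d)                 ≡⟨ cong (b n (suc d)) (ℕ.+-suc n d) ⟩
      b n (suc d) (suc (n +ℕ d))               ≈⟨ b-pascal n d (n +ℕ d) ⟩
      b n d (n +ℕ d) + b n d (suc (n +ℕ d))    ≈⟨ +-congˡ (b-vanish n d _ ℕ.≤-refl) ⟩
      b n d (n +ℕ d) + 0#                      ≈⟨ +-identityʳ _ ⟩
      b n d (n +ℕ d)                           ∎

    pascal-convolution-a≈b : ∀ n d k → sumTo R k (λ ν → ι R (d C (k ∸ ν)) * a R α n ν) ≈ b n d k
    pascal-convolution-a≈b n d k = begin
      sumTo R k (λ ν → D ν * sumTo R n (λ μ → T μ ν))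
        ≈⟨ sumTo-cong k (λ ν → sym (sumTo-*ˡ n (D ν) (λ μ → T μ ν))) ⟩
      sumTo R k (λ ν → sumTo R n (λ μ → D ν * T μ ν))
        ≈⟨ sumTo-swap k n (λ ν μ → D ν * T μ ν) ⟩
      sumTo R n (λ μ → sumTo R k (λ ν → D ν * T μ ν))
        ≈⟨ sumTo-cong n (λ μ → trans (sumTo-cong k (λ ν → shuffle (D ν) (ι R (n C μ)) (ι R (μ C ν)) (α μ)))
                                      (sumTo-*ˡ k _ _)) ⟩
      sumTo R n (λ μ → ι R (n C μ) * α μ * sumTo R k (λ ν → D ν * ι R (μ C ν)))
        ≈⟨ sumTo-cong n (λ μ → *-congˡ (vandermonde d μ k)) ⟩
      sumTo R n (λ μ → ι R (n C μ) * α μ * ι R ((μ +ℕ d) C k))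
        ≈⟨ sumTo-cong n (λ μ → trans (*-congˡ (reflexive (cong (λ m → ι R (m C k)) (ℕ.+-comm μ d)))) (xy∙z≈xz∙y _ _ _)) ⟩
      b n d k ∎
      where
      D : ℕ → Carrier
      D ν = ι R (d C (k ∸ ν))
      T : ℕ → ℕ → Carrier
      T μ ν = ι R (n C μ) * ι R (μ C ν) * α μ
      shuffle : ∀ w x y z → w * (x * y * z) ≈ x * z * (w * y)
      shuffle w x y z = trans (*-congˡ (xy∙z≈xz∙y x y z)) (x∙yz≈y∙xz w (x * z) y)

    reversed-sum≈b : ∀ {n T} k → n ≤ T →
      sumTo R n (λ ν → ι R ((T ∸ ν) C k) * ι R (n C ν) * α (n ∸ ν)) ≈ b n (T ∸ n) k
    reversed-sum≈b {n} {T} k n≤T = trans (sumTo-reverse n _) (sumTo-cong-≤ n term)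
      where
      term : ∀ μ → μ ≤ n →
        ι R ((T ∸ (n ∸ μ)) C k) * ι R (n C (n ∸ μ)) * α (n ∸ (n ∸ μ)) ≈ ι R (n C μ) * ι R ((T ∸ n +ℕ μ) C k) * α μ
      term μ μ≤n = begin
        ι R ((T ∸ (n ∸ μ)) C k) * ι R (n C (n ∸ μ)) * α (n ∸ (n ∸ μ))
          ≈⟨ *-cong (*-cong (reflexive (cong (λ i → ι R (i C k)) (m∸[n∸o]≡m∸n+o n≤T μ≤n)))
                            (reflexive (cong (ι R) (≡.sym (nCk≡nC[n∸k] μ≤n)))))
                    (reflexive (cong α (ℕ.m∸[m∸n]≡n μ≤n))) ⟩
        ι R ((T ∸ n +ℕ μ) C k) * ι R (n C μ) * α μ
          ≈⟨ *-congʳ (*-comm _ _) ⟩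
        ι R (n C μ) * ι R ((T ∸ n +ℕ μ) C k) * α μ ∎

    doubled-sum≈b : ∀ n k → k ≤ n → n ≤ 2 *ℕ k →
      sumTo R k (λ ν → ι R ((2 *ℕ k ∸ ν) C k) * ι R (n C ν) * α (n ∸ ν)) ≈ b n (2 *ℕ k ∸ n) k
    doubled-sum≈b n k k≤n n≤2k = trans (sym (sumTo-truncate n k f k≤n vanish)) (reversed-sum≈b k n≤2k)
      where
      f : ℕ → Carrier
      f ν = ι R ((2 *ℕ k ∸ ν) C k) * ι R (n C ν) * α (n ∸ ν)
      vanish : ∀ ν → k < ν → ν ≤ n → f ν ≈ 0#
      vanish ν k<ν ν≤n =
        trans (*-congʳ (trans (*-congʳ (ι-C-vanish (k<ν≤2k⇒2k∸ν<k k<ν (ℕ.≤-trans ν≤n n≤2k)))) (zeroˡ _))) (zeroˡ _)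

    A-at-0 : ∀ m → A R α m 0# ≈ α m
    A-at-0 m = begin
      A R α m 0#                    ≈⟨ sumTo-truncate m 0 _ z≤n (λ { (suc ν) _ _ → trans (*-congˡ (zeroˡ _)) (zeroʳ _) }) ⟩
      ι R 1 * α m * 1#              ≈⟨ *-identityʳ _ ⟩
      ι R 1 * α m                   ≈⟨ *-congʳ ι-1 ⟩
      1# * α m                      ≈⟨ *-identityˡ _ ⟩
      α m                           ∎

    A-at-1 : ∀ m {x} → x ≈ 1# → A R α m x ≈ α₂ R α m 0
    A-at-1 m {x} x≈1 = begin
      A R α m x
        ≈⟨ sumTo-cong m (λ ν → trans (*-congˡ (pow-1 ν)) (*-identityʳ _)) ⟩
      sumTo R m (λ ν → ι R (m C ν) * α (m ∸ ν))
        ≈⟨ sumTo-reverse m _ ⟩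
      sumTo R m (λ ν → ι R (m C (m ∸ ν)) * α (m ∸ (m ∸ ν)))
        ≈⟨ sumTo-cong-≤ m (λ ν ν≤m → *-cong (reflexive (cong (ι R) (≡.sym (nCk≡nC[n∸k] ν≤m))))
                                             (reflexive (cong α (ℕ.m∸[m∸n]≡n ν≤m)))) ⟩
      α₂ R α m 0 ∎
      where
      pow-1 : ∀ ν → pow R x ν ≈ 1#
      pow-1 zero    = refl
      pow-1 (suc ν) = trans (*-cong x≈1 (pow-1 ν)) (*-identityˡ 1#)

    reflection⇒α₂-self-dual : (∀ m x → A R α m (1# - x) ≈ ε m * A R α m x) → ∀ m → α₂ R α m 0 ≈ ε m * α m
    reflection⇒α₂-self-dual reflection m = begin
      α₂ R α m 0          ≈⟨ A-at-1 m (trans (+-congˡ -0#≈0#) (+-identityʳ 1#)) ⟨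
      A R α m (1# - 0#)   ≈⟨ reflection m 0# ⟩
      ε m * A R α m 0#    ≈⟨ *-congˡ (A-at-0 m) ⟩
      ε m * α m           ∎

  module _ (α : ℕ → Carrier) (α₂-self-dual : ∀ m → α₂ R α m 0 ≈ ε m * α m) where

    α₂-symmetric : ∀ r s → α₂ R α r s ≈ ε (s +ℕ r) * α₂ R α s r
    α₂-symmetric r zero = begin
      α₂ R α r 0          ≈⟨ α₂-self-dual r ⟩
      ε r * α r           ≈⟨ *-congˡ α₂-0 ⟨
      ε r * α₂ R α 0 r    ∎
      where
      α₂-0 : α₂ R α 0 r ≈ α r
      α₂-0 = trans (*-congʳ ι-1) (trans (*-identityˡ _) (reflexive (cong α (ℕ.+-identityʳ r))))
    α₂-symmetric r (suc s) = begin
      α₂ R α r (suc s)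
        ≈⟨ xyx⁻¹≈y (α₂ R α r s) _ ⟨
      α₂ R α r s + α₂ R α r (suc s) - α₂ R α r s
        ≈⟨ +-cong (sym (α₂-pascal α r s)) (-‿cong (α₂-symmetric r s)) ⟩
      α₂ R α (suc r) s - t * X
        ≈⟨ +-congʳ (trans (α₂-symmetric (suc r) s) (*-congʳ (trans (reflexive (cong ε (ℕ.+-suc s r))) (ε-suc (s +ℕ r))))) ⟩
      - t * Y - t * X
        ≈⟨ +-congʳ (-‿distribˡ-* t Y) ⟨
      - (t * Y) - t * X
        ≈⟨ -‿+-comm (t * Y) (t * X) ⟩
      - (t * Y + t * X)
        ≈⟨ -‿cong (distribˡ t Y X) ⟨
      - (t * (Y + X))
        ≈⟨ -‿distribˡ-* t (Y + X) ⟩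
      - t * (Y + X)
        ≈⟨ *-cong (sym (ε-suc (s +ℕ r))) (+-comm Y X) ⟩
      ε (suc s +ℕ r) * (X + Y)
        ≈⟨ *-congˡ (α₂-pascal α s r) ⟨
      ε (suc s +ℕ r) * α₂ R α (suc s) r ∎
      where
      t X Y : Carrier
      t = ε (s +ℕ r)
      X = α₂ R α s r
      Y = α₂ R α s (suc r)

    a-symmetric : ∀ k l → a R α (k +ℕ l) k ≈ ε (k +ℕ l) * a R α (k +ℕ l) l
    a-symmetric k l = begin
      a R α (k +ℕ l) k                                   ≈⟨ a-as-α₂ α k l ≡.refl ⟩
      ι R ((k +ℕ l) C k) * α₂ R α l k                    ≈⟨ *-cong (reflexive (cong (ι R) (choose-symmetric k l))) (α₂-symmetric l k) ⟩
      ι R ((k +ℕ l) C l) * (ε (k +ℕ l) * α₂ R α k l)     ≈⟨ x∙yz≈y∙xz _ _ _ ⟩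
      ε (k +ℕ l) * (ι R ((k +ℕ l) C l) * α₂ R α k l)     ≈⟨ *-congˡ (a-as-α₂ α l k (ℕ.+-comm l k)) ⟨
      ε (k +ℕ l) * a R α (k +ℕ l) l                      ∎

    b-symmetric : ∀ d {n} k l → k +ℕ l ≡ n +ℕ d → b α n d k ≈ ε n * b α n d l
    -- b α n 0 and a R α n agree definitionally.
    b-symmetric zero {n} k l k+l≡n+0 =
      subst (λ m → a R α m k ≈ ε m * a R α m l) (≡.trans k+l≡n+0 (ℕ.+-identityʳ n)) (a-symmetric k l)
    b-symmetric (suc d) {n} zero l l≡n+1+d = begin
      b α n d 0                     ≈⟨ b-symmetric d 0 (n +ℕ d) ≡.refl ⟩
      ε n * b α n d (n +ℕ d)        ≈⟨ *-congˡ (b-top α n d l≡n+1+d) ⟨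
      ε n * b α n (suc d) l         ∎
    b-symmetric (suc d) {n} (suc k) zero k+0≡n+1+d = begin
      b α n (suc d) (suc k)         ≈⟨ b-top α n d (≡.trans (≡.sym (ℕ.+-identityʳ (suc k))) k+0≡n+1+d) ⟩
      b α n d (n +ℕ d)              ≈⟨ b-symmetric d (n +ℕ d) 0 (ℕ.+-identityʳ (n +ℕ d)) ⟩
      ε n * b α n d 0               ∎
    b-symmetric (suc d) {n} (suc k) (suc l) k+l≡n+d = begin
      b α n (suc d) (suc k)                        ≈⟨ b-pascal α n d k ⟩
      b α n d k + b α n d (suc k)                  ≈⟨ +-cong (b-symmetric d k (suc l) e₁) (b-symmetric d (suc k) l e₂) ⟩
      ε n * b α n d (suc l) + ε n * b α n d l      ≈⟨ distribˡ (ε n) _ _ ⟨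
      ε n * (b α n d (suc l) + b α n d l)          ≈⟨ *-congˡ (+-comm _ _) ⟩
      ε n * (b α n d l + b α n d (suc l))          ≈⟨ *-congˡ (b-pascal α n d l) ⟨
      ε n * b α n (suc d) (suc l)                  ∎
      where
      e₁ : k +ℕ suc l ≡ n +ℕ d
      e₁ = ℕ.suc-injective (≡.trans k+l≡n+d (ℕ.+-suc n d))
      e₂ : suc k +ℕ l ≡ n +ℕ d
      e₂ = ≡.trans (≡.sym (ℕ.+-suc k l)) e₁

corollary5p4 : ∀ {c ℓ : Level} (R : CommutativeRing c ℓ) → TorsionFree R →
    let open CommutativeRing R in
    (α : ℕ → Carrier) →
    (∀ (m : ℕ) (x : Carrier) → A R α m (1# - x) ≈ pow R (- 1#) m * A R α m x) →
    (n : ℕ) → n % 2 ≡ 1 →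
    (k : ℕ) → suc n / 2 ≤ k → k ≤ n →
    (sumTo R k (λ ν → ι R ((2 *ℕ k ∸ n) C (k ∸ ν)) * a R α n ν) ≈ 0#)
    × (sumTo R k (λ ν → ι R ((2 *ℕ k ∸ n) C (k ∸ ν)) * ι R (n C ν) * α₂ R α (n ∸ ν) ν) ≈ 0#)
    × (sumTo R k (λ ν → ι R ((2 *ℕ k ∸ ν) C k) * ι R (n C ν) * α (n ∸ ν)) ≈ 0#)
corollary5p4 R torsionFree α reflection n odd k half≤k k≤n = first , second , third
  where
  open CommutativeRing R
  open BinomialSums R
  n≤2k : n ≤ 2 *ℕ k
  n≤2k = ℕ.<⇒≤ (odd∧[1+n]/2≤k⇒n<2k odd half≤k)
  d : ℕ
  d = 2 *ℕ k ∸ n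
  k+k≡n+d : k +ℕ k ≡ n +ℕ d
  k+k≡n+d = ≡.sym (≡.trans (ℕ.m+[n∸m]≡n n≤2k) (cong (k +ℕ_) (ℕ.+-identityʳ k)))
  b≈0 : b α n d k ≈ 0#
  b≈0 = x≈-x⇒x≈0 torsionFree
    (trans (b-symmetric α (reflection⇒α₂-self-dual α reflection) d k k k+k≡n+d) (ε-odd n odd _))
  first : sumTo R k (λ ν → ι R (d C (k ∸ ν)) * a R α n ν) ≈ 0#
  first = trans (pascal-convolution-a≈b α n d k) b≈0
  second : sumTo R k (λ ν → ι R (d C (k ∸ ν)) * ι R (n C ν) * α₂ R α (n ∸ ν) ν) ≈ 0#
  second = trans (sumTo-cong k (λ ν → trans (*-assoc _ _ _) (*-congˡ (choose-mul-α₂ α n ν)))) first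
  third : sumTo R k (λ ν → ι R ((2 *ℕ k ∸ ν) C k) * ι R (n C ν) * α (n ∸ ν)) ≈ 0#
  third = trans (doubled-sum≈b α n k k≤n n≤2k) b≈0
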